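{- If $G$ is a $\gamma_{tR}$-edge-supercritical graph, then every edge $e\in E(G)$ not incident with a vertex of degree $1$ satisfies $\gamma_{tR}(G-e)=\gamma_{tR}(G)$.
   Context: All graphs are finite and simple. A total Roman dominating function (TRD-function) on a graph $G$ with no isolated vertices is a function $f:V(G)\to\{0,1,2\}$ such that every vertex $v$ with $f(v)=0$ is adjacent to some $u$ with $f(u)=2$, and the subgraph induced by $\{w:f(w)>0\}$ has no isolated vertices; its weight is $\sum_v f(v)$ and $\gamma_{tR}(G)$ is the minimum weight. A graph $G$ with no isolated vertices is $\gamma_{tR}$-edge-supercritical if $E(\overline{G})\neq\emptyset$ and $\gamma_{tR}(G+e)\leq\gamma_{tR}(G)-2$ for every $e\in E(\overline{G})$. -}

module Defs where

open import Data.Nat using (ℕ; _≤_; _+_)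
open import Data.Fin using (Fin; toℕ; _≟_)
open import Data.Bool using (Bool; true; false; _∨_; _∧_; not)
open import Data.List using (List; allFin; map; filterᵇ; length)
open import Data.Nat.ListAction using (sum)
open import Data.Product using (Σ; _×_; ∃-syntax)
open import Relation.Nullary using (¬_)
open import Relation.Nullary.Decidable using (⌊_⌋)
open import Relation.Binary.PropositionalEquality using (_≡_; _≢_)

Graph : ℕ → Set
Graph n = Fin n → Fin n → Bool

IsSimple : ∀ {n} → Graph n → Set
IsSimple {n} G = (∀ (x y : Fin n) → G x y ≡ G y x) × (∀ (x : Fin n) → G x x ≡ false)

Adjacent : ∀ {n} → Graph n → Fin n → Fin n → Set
Adjacent G x y = G x y ≡ true

NoIsolated : ∀ {n} → Graph n → Set
NoIsolated {n} G = ∀ (v : Fin n) → ∃[ u ] Adjacent G v u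

degree : ∀ {n} → Graph n → Fin n → ℕ
degree {n} G v = length (filterᵇ (G v) (allFin n))

samePair : ∀ {n} → Fin n → Fin n → Fin n → Fin n → Bool
samePair u v x y = (⌊ x ≟ u ⌋ ∧ ⌊ y ≟ v ⌋) ∨ (⌊ x ≟ v ⌋ ∧ ⌊ y ≟ u ⌋)

addEdge : ∀ {n} → Graph n → Fin n → Fin n → Graph n
addEdge G u v x y = G x y ∨ samePair u v x y

removeEdge : ∀ {n} → Graph n → Fin n → Fin n → Graph n
removeEdge G u v x y = G x y ∧ not (samePair u v x y)

weight : ∀ {n} → (Fin n → Fin 3) → ℕ
weight {n} f = sum (map (λ v → toℕ (f v)) (allFin n))

IsTRDF : ∀ {n} → Graph n → (Fin n → Fin 3) → Set
IsTRDF {n} G f =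
  (∀ (v : Fin n) → toℕ (f v) ≡ 0 → ∃[ u ] (Adjacent G v u × toℕ (f u) ≡ 2)) ×
  (∀ (v : Fin n) → toℕ (f v) ≢ 0 → ∃[ u ] (Adjacent G v u × toℕ (f u) ≢ 0))

IsγtR : ∀ {n} → Graph n → ℕ → Set
IsγtR {n} G k =
  (∃[ f ] (IsTRDF G f × weight f ≡ k)) ×
  (∀ (f : Fin n → Fin 3) → IsTRDF G f → k ≤ weight f)

IsSupercritical : ∀ {n} → Graph n → Set
IsSupercritical {n} G =
  NoIsolated G ×
  (∃[ u ] ∃[ v ] (u ≢ v × G u v ≡ false)) ×
  (∀ (u v : Fin n) → u ≢ v → G u v ≡ false →
     ∀ (k k' : ℕ) → IsγtR G k → IsγtR (addEdge G u v) k' → k' + 2 ≤ k)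

module Submission where

-- Since G - uv ⊆ G, every TRDF of G - uv is one of G, so γtR(G - uv) ≥ γtR(G) = k and it
-- suffices to find a TRDF of G - uv of weight at most k.  Supercriticality supplies, for a
-- non-edge xy, a TRDF g of G + xy of weight at most k - 2; raising two labels of g to at
-- least 1, or one label to 2, then repairs the vertices that lost the edge xy or uv,
-- at a cost of at most 2.  Whenever such a repair would give a TRDF of G itself of weight
-- below k, that configuration of labels is impossible.  The non-edge is chosen by the local
-- structure around uv: a neighbour y of v outside N[u] (add uy), two non-adjacent common
-- neighbours s, t (add st), or a neighbour y ∉ N[u] of a common neighbour w (add uy).  If
-- there is none, u, v and any further neighbour w of u (it exists as deg u ≠ 1) are pairwise
-- twins.  Exchanging the labels of twins is an automorphism, so some γtR-function of G
-- carries the largest label of u, v, w on w; it remains a TRDF of G - uv.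

open import Defs
open import Data.Bool as Bool using (true; false; _∧_; _∨_; not; T)
open import Data.Bool.Properties using (T-≡; ∨-comm; ∨-identityʳ; ¬-not; ⇔→≡)
open import Data.Empty using (⊥; ⊥-elim)
open import Data.Fin using (Fin; zero; suc; toℕ; _≟_; finToFun; funToFin; punchIn)
open import Data.Fin.Permutation using (Permutation; _⟨$⟩ʳ_; _⟨$⟩ˡ_; inverseʳ; transpose)
open import Data.Fin.Properties using (any?; all?; toℕ≤pred[n]; finToFun-funToFin; punchInᵢ≢i)
open import Data.List using (List; []; _∷_; allFin; length; tabulate)
open import Data.List.Properties using (map-tabulate)
open import Data.List.Membership.Propositional using (_∈_)
open import Data.List.Membership.Propositional.Properties using (∈-filter⁺; ∈-allFin)
open import Data.List.Relation.Unary.All as All using (All; _∷_)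
import Data.List.Relation.Unary.All.Properties as All
open import Data.List.Relation.Unary.AllPairs using (_∷_)
open import Data.List.Relation.Unary.Unique.Propositional using (Unique)
import Data.List.Relation.Unary.Unique.Propositional.Properties as Unique
open import Data.Nat using (ℕ; zero; suc; _+_; _≤_; z≤n; s≤s; _≤?_) renaming (_≟_ to _≟ℕ_)
open import Data.Nat.ListAction using (sum)
open import Data.Nat.Properties
  using ( ≤-refl; ≤-trans; ≤-reflexive; ≤-antisym; ≤-total; <-irrefl; ≰⇒>; n≤0⇒n≡0; n≢0⇒n>0
        ; +-assoc; +-cancelʳ-≤; +-monoˡ-≤; +-monoʳ-≤; +-monoʳ-<; m≤m+n; m≤n+m
        ; module ≤-Reasoning)
open import Algebra.Properties.CommutativeSemigroup Data.Nat.Properties.+-commutativeSemigroup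
  using (xy∙z≈zy∙x; x∙yz≈xz∙y)
open import Algebra.Properties.CommutativeMonoid.Sum Data.Nat.Properties.+-0-commutativeMonoid
  using (sum-remove; sum-permute; sum-cong-≗)
  renaming (sum to ∑)
open import Data.Product using (∃; ∃-syntax; _×_; _,_; proj₁; proj₂; uncurry)
open import Data.Sum using (inj₁; inj₂)
open import Data.Vec.Functional using (updateAt; removeAt)
open import Data.Vec.Functional.Properties using (updateAt-updates; updateAt-minimal)
open import Function using (_∘_; const; Equivalence; mk⇔)
open import Relation.Binary.PropositionalEquality
open import Relation.Nullary using (Dec; yes; no; ¬_)
open import Relation.Nullary.Decidable using (_×-dec_; ¬?; ⌊_⌋; map′; T?)

Labelling : ℕ → Set
Labelling n = Fin n → Fin 3

_≤ᶠ_ : ∀ {n} → Labelling n → Labelling n → Set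
f ≤ᶠ g = ∀ x → toℕ (f x) ≤ toℕ (g x)

≤ᶠ-refl : ∀ {n} {f : Labelling n} → f ≤ᶠ f
≤ᶠ-refl x = ≤-refl

≤ᶠ-trans : ∀ {n} {f g h : Labelling n} → f ≤ᶠ g → g ≤ᶠ h → f ≤ᶠ h
≤ᶠ-trans f≤g g≤h x = ≤-trans (f≤g x) (g≤h x)

two⇒pos : ∀ {m : ℕ} → m ≡ 2 → m ≢ 0
two⇒pos refl ()

pos-mono : ∀ {a b : Fin 3} → toℕ a ≤ toℕ b → toℕ a ≢ 0 → toℕ b ≢ 0
pos-mono {a} a≤b a≢0 b≡0 = a≢0 (n≤0⇒n≡0 (subst (toℕ a ≤_) b≡0 a≤b))

two-mono : ∀ {a b : Fin 3} → toℕ a ≤ toℕ b → toℕ a ≡ 2 → toℕ b ≡ 2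
two-mono {b = b} a≤b a≡2 = ≤-antisym (toℕ≤pred[n] b) (subst (_≤ toℕ b) a≡2 a≤b)

zero-antimono : ∀ {n} {f g : Labelling n} {x} → f ≤ᶠ g → toℕ (g x) ≡ 0 → toℕ (f x) ≡ 0
zero-antimono {x = x} f≤g gx≡0 = n≤0⇒n≡0 (subst (_ ≤_) gx≡0 (f≤g x))

two : Fin 3
two = suc (suc zero)

atLeast1 : Fin 3 → Fin 3
atLeast1 zero = suc zero
atLeast1 c    = c

raise : ∀ {n} → Labelling n → Fin n → Labelling n
raise f v = updateAt f v atLeast1

set2 : ∀ {n} → Labelling n → Fin n → Labelling n
set2 f v = updateAt f v (const two)

updateAt-≥ : ∀ {n} (f : Labelling n) v {φ} → (∀ c → toℕ c ≤ toℕ (φ c)) → f ≤ᶠ updateAt f v φ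
updateAt-≥ f v φ≥ x with x ≟ v
... | yes refl = subst (λ c → toℕ (f v) ≤ toℕ c) (sym (updateAt-updates v f)) (φ≥ (f v))
... | no x≢v   = ≤-reflexive (cong toℕ (sym (updateAt-minimal x v f x≢v)))

raise-≥ : ∀ {n} (f : Labelling n) v → f ≤ᶠ raise f v
raise-≥ f v = updateAt-≥ f v λ { zero → z≤n ; (suc c) → ≤-refl }

set2-≥ : ∀ {n} (f : Labelling n) v → f ≤ᶠ set2 f v
set2-≥ f v = updateAt-≥ f v toℕ≤pred[n]

raise-pos : ∀ {n} (f : Labelling n) v → toℕ (raise f v v) ≢ 0
raise-pos f v rewrite updateAt-updates v {atLeast1} f = atLeast1-pos (f v)
  where
  atLeast1-pos : ∀ c → toℕ (atLeast1 c) ≢ 0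
  atLeast1-pos zero    ()
  atLeast1-pos (suc c) ()

set2-two : ∀ {n} (f : Labelling n) v → toℕ (set2 f v v) ≡ 2
set2-two f v = cong toℕ (updateAt-updates v f)

raise₂-≥ : ∀ {n} (f : Labelling n) a b → f ≤ᶠ raise (raise f a) b
raise₂-≥ f a b = ≤ᶠ-trans (raise-≥ f a) (raise-≥ (raise f a) b)

raise₂-pos₁ : ∀ {n} (f : Labelling n) a b → toℕ (raise (raise f a) b a) ≢ 0
raise₂-pos₁ f a b = pos-mono (raise-≥ (raise f a) b a) (raise-pos f a)

weight≡∑ : ∀ {n} (f : Labelling n) → weight f ≡ ∑ (toℕ ∘ f)
weight≡∑ f = trans (cong sum (map-tabulate (λ i → i) (toℕ ∘ f))) (sum-tabulate (toℕ ∘ f))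
  where
  sum-tabulate : ∀ {m} (h : Fin m → ℕ) → sum (tabulate h) ≡ ∑ h
  sum-tabulate {zero}  h = refl
  sum-tabulate {suc m} h = cong (h zero +_) (sum-tabulate (h ∘ suc))

weight-≗ : ∀ {n} {f g : Labelling n} → (∀ x → f x ≡ g x) → weight f ≡ weight g
weight-≗ {f = f} {g} f≗g = trans (weight≡∑ f) (trans (sum-cong-≗ (cong toℕ ∘ f≗g)) (sym (weight≡∑ g)))

weight-updateAt : ∀ {n} (f : Labelling n) i φ → weight (updateAt f i φ) + toℕ (f i) ≡ weight f + toℕ (φ (f i))
weight-updateAt {suc n} f i φ = begin
  weight f′ + toℕ (f i)              ≡⟨ cong (_+ toℕ (f i)) (split f′) ⟩
  (toℕ (f′ i) + rest′) + toℕ (f i)   ≡⟨ cong₂ (λ a b → (a + b) + toℕ (f i)) (cong toℕ (updateAt-updates i f)) rest′≡rest ⟩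
  (toℕ (φ (f i)) + rest) + toℕ (f i) ≡⟨ xy∙z≈zy∙x (toℕ (φ (f i))) rest (toℕ (f i)) ⟩
  (toℕ (f i) + rest) + toℕ (φ (f i)) ≡⟨ cong (_+ toℕ (φ (f i))) (split f) ⟨
  weight f + toℕ (φ (f i))           ∎
  where
  open ≡-Reasoning
  f′ = updateAt f i φ
  rest′ = ∑ (removeAt (toℕ ∘ f′) i)
  rest = ∑ (removeAt (toℕ ∘ f) i)
  split : ∀ h → weight h ≡ toℕ (h i) + ∑ (removeAt (toℕ ∘ h) i)
  split h = trans (weight≡∑ h) (sum-remove {i = i} (toℕ ∘ h))
  rest′≡rest : rest′ ≡ rest
  rest′≡rest = sum-cong-≗ λ j → cong toℕ (updateAt-minimal (punchIn i j) i f (punchInᵢ≢i i j))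

weight-updateAt-≤ : ∀ {n} (f : Labelling n) i φ {d} → toℕ (φ (f i)) ≤ toℕ (f i) + d →
                    weight (updateAt f i φ) ≤ weight f + d
weight-updateAt-≤ f i φ {d} φ≤ = +-cancelʳ-≤ (toℕ (f i)) _ _ (begin
  weight (updateAt f i φ) + toℕ (f i) ≡⟨ weight-updateAt f i φ ⟩
  weight f + toℕ (φ (f i))            ≤⟨ +-monoʳ-≤ (weight f) φ≤ ⟩
  weight f + (toℕ (f i) + d)          ≡⟨ x∙yz≈xz∙y (weight f) (toℕ (f i)) d ⟩
  weight f + d + toℕ (f i)            ∎)
  where open ≤-Reasoning

weight-raise : ∀ {n} (f : Labelling n) v → weight (raise f v) ≤ weight f + 1
weight-raise f v = weight-updateAt-≤ f v atLeast1 (atLeast1-cost (f v))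
  where
  atLeast1-cost : ∀ c → toℕ (atLeast1 c) ≤ toℕ c + 1
  atLeast1-cost zero    = s≤s z≤n
  atLeast1-cost (suc c) = m≤m+n _ 1

weight-raise₂ : ∀ {n} (f : Labelling n) a b → weight (raise (raise f a) b) ≤ weight f + 2
weight-raise₂ f a b = begin
  weight (raise (raise f a) b) ≤⟨ weight-raise (raise f a) b ⟩
  weight (raise f a) + 1       ≤⟨ +-monoˡ-≤ 1 (weight-raise f a) ⟩
  weight f + 1 + 1             ≡⟨ +-assoc (weight f) 1 1 ⟩
  weight f + 2                 ∎
  where open ≤-Reasoning

weight-set2 : ∀ {n} (f : Labelling n) v → weight (set2 f v) ≤ weight f + 2
weight-set2 f v = weight-updateAt-≤ f v (const two) (m≤n+m 2 (toℕ (f v)))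

weight-set2-pos : ∀ {n} (f : Labelling n) v → toℕ (f v) ≢ 0 → weight (set2 f v) ≤ weight f + 1
weight-set2-pos f v fv≢0 = weight-updateAt-≤ f v (const two) (+-monoˡ-≤ 1 (n≢0⇒n>0 fv≢0))

weight-∘-permutation : ∀ {n} (f : Labelling n) (π : Permutation n n) → weight (f ∘ (π ⟨$⟩ʳ_)) ≡ weight f
weight-∘-permutation f π = begin
  weight (f ∘ (π ⟨$⟩ʳ_)) ≡⟨ weight≡∑ (f ∘ (π ⟨$⟩ʳ_)) ⟩
  ∑ (toℕ ∘ f ∘ (π ⟨$⟩ʳ_)) ≡⟨ sum-permute (toℕ ∘ f) π ⟨
  ∑ (toℕ ∘ f)            ≡⟨ weight≡∑ f ⟨
  weight f               ∎
  where open ≡-Reasoning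

-- A record rather than a product, so that G and f can be inferred from it by unification.
record IsTRDFAt {n} (G : Graph n) (f : Labelling n) (z : Fin n) : Set where
  constructor _,_
  field
    when-zero : toℕ (f z) ≡ 0 → ∃[ t ] (Adjacent G z t × toℕ (f t) ≡ 2)
    when-pos  : toℕ (f z) ≢ 0 → ∃[ t ] (Adjacent G z t × toℕ (f t) ≢ 0)

IsTRDF⁺ : ∀ {n} {G : Graph n} {f} → (∀ z → IsTRDFAt G f z) → IsTRDF G f
IsTRDF⁺ at = IsTRDFAt.when-zero ∘ at , IsTRDFAt.when-pos ∘ at

IsTRDF⁻ : ∀ {n} {G : Graph n} {f} → IsTRDF G f → ∀ z → IsTRDFAt G f z
IsTRDF⁻ (when-zero , when-pos) z = when-zero z , when-pos z

IsTRDFAt-two : ∀ {n} {G : Graph n} {f z} t → Adjacent G z t → toℕ (f t) ≡ 2 → IsTRDFAt G f z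
IsTRDFAt-two t zt ft≡2 = (λ _ → t , zt , ft≡2) , (λ _ → t , zt , two⇒pos ft≡2)

IsTRDFAt-pos : ∀ {n} {G : Graph n} {f z} t → toℕ (f z) ≢ 0 → Adjacent G z t → toℕ (f t) ≢ 0 → IsTRDFAt G f z
IsTRDFAt-pos t fz≢0 zt ft≢0 = (λ fz≡0 → ⊥-elim (fz≢0 fz≡0)) , (λ _ → t , zt , ft≢0)

-- Raising labels keeps every 2 a 2 and every positive label positive.
IsTRDFAt-mono : ∀ {n} {G G′ : Graph n} {f g : Labelling n} {z} →
                (∀ t → Adjacent G z t → toℕ (f t) ≢ 0 → Adjacent G′ z t) →
                f ≤ᶠ g → IsTRDFAt G f z → IsTRDFAt G′ g z
IsTRDFAt-mono {G = G} {G′} {f} {g} {z} edges f≤g (when-zero , when-pos) = when-zero′ , when-pos′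
  where
  transfer-two : ∃[ t ] (Adjacent G z t × toℕ (f t) ≡ 2) → ∃[ t ] (Adjacent G′ z t × toℕ (g t) ≡ 2)
  transfer-two (t , zt , ft≡2) = t , edges t zt (two⇒pos ft≡2) , two-mono (f≤g t) ft≡2
  when-zero′ : toℕ (g z) ≡ 0 → ∃[ t ] (Adjacent G′ z t × toℕ (g t) ≡ 2)
  when-zero′ gz≡0 = transfer-two (when-zero (zero-antimono f≤g gz≡0))
  when-pos′ : toℕ (g z) ≢ 0 → ∃[ t ] (Adjacent G′ z t × toℕ (g t) ≢ 0)
  when-pos′ _ with toℕ (f z) ≟ℕ 0
  ... | yes fz≡0 = let (t , zt , gt≡2) = transfer-two (when-zero fz≡0) in t , zt , two⇒pos gt≡2
  ... | no fz≢0  = let (t , zt , ft≢0) = when-pos fz≢0 in t , edges t zt ft≢0 , pos-mono (f≤g t) ft≢0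

IsTRDF-mono : ∀ {n} {G G′ : Graph n} {f g : Labelling n} →
              (∀ z t → Adjacent G z t → Adjacent G′ z t) → f ≤ᶠ g → IsTRDF G f → IsTRDF G′ g
IsTRDF-mono G⊆G′ f≤g trdf = IsTRDF⁺ λ z → IsTRDFAt-mono (λ t zt _ → G⊆G′ z t zt) f≤g (IsTRDF⁻ trdf z)

IsTRDF-≗ : ∀ {n} {G : Graph n} {f g : Labelling n} → (∀ x → f x ≡ g x) → IsTRDF G f → IsTRDF G g
IsTRDF-≗ f≗g = IsTRDF-mono (λ _ _ zt → zt) (≤-reflexive ∘ cong toℕ ∘ f≗g)

IsTRDFAt? : ∀ {n} (G : Graph n) f z → Dec (IsTRDFAt G f z)
IsTRDFAt? G f z = map′ (uncurry _,_) (λ (when-zero , when-pos) → when-zero , when-pos) (when-zero? ×-dec when-pos?)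
  where
  →-dec : {A B : Set} → Dec A → Dec B → Dec (A → B)
  →-dec _       (yes b) = yes λ _ → b
  →-dec (no ¬a) _       = yes λ a → ⊥-elim (¬a a)
  →-dec (yes a) (no ¬b) = no λ a→b → ¬b (a→b a)
  when-zero? = →-dec (toℕ (f z) ≟ℕ 0) (any? λ t → (G z t Bool.≟ true) ×-dec (toℕ (f t) ≟ℕ 2))
  when-pos?  = →-dec (¬? (toℕ (f z) ≟ℕ 0)) (any? λ t → (G z t Bool.≟ true) ×-dec ¬? (toℕ (f t) ≟ℕ 0))

IsTRDF? : ∀ {n} (G : Graph n) f → Dec (IsTRDF G f)
IsTRDF? G f with all? (IsTRDFAt? G f)
... | yes at = yes (IsTRDF⁺ at)
... | no ¬at = no (¬at ∘ IsTRDF⁻)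

γtR≤ : ∀ {n} → Graph n → ℕ → Set
γtR≤ G k = ∃[ h ] (IsTRDF G h × weight h ≤ k)

γtR≤? : ∀ {n} (G : Graph n) k → Dec (γtR≤ G k)
γtR≤? {n} G k with any? (λ i → IsTRDF? G (finToFun {3} {n} i) ×-dec (weight (finToFun {3} {n} i) ≤? k))
... | yes (i , found) = yes (finToFun i , found)
... | no ¬found = no λ (h , h-trdf , h≤k) →
        ¬found (funToFin h , IsTRDF-≗ (sym ∘ roundtrip h) h-trdf , subst (_≤ k) (weight-≗ (sym ∘ roundtrip h)) h≤k)
  where
  roundtrip = finToFun-funToFin

γtR-exists : ∀ {n} (G : Graph n) {f} → IsTRDF G f → ∃[ k ] IsγtR G k
γtR-exists G {f} f-trdf = descend (weight f) f f-trdf ≤-refl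
  where
  descend : ∀ B f → IsTRDF G f → weight f ≤ B → ∃[ k ] IsγtR G k
  descend zero f f-trdf f≤0 =
    weight f , (f , f-trdf , refl) , λ g _ → subst (_≤ weight g) (sym (n≤0⇒n≡0 f≤0)) z≤n
  descend (suc B) f f-trdf f≤1+B with γtR≤? G B
  ... | yes (g , g-trdf , g≤B) = descend B g g-trdf g≤B
  ... | no ¬γtR≤B =
    weight f , (f , f-trdf , refl) , λ g g-trdf → ≤-trans f≤1+B (≰⇒> λ g≤B → ¬γtR≤B (g , g-trdf , g≤B))

IsγtR-intro : ∀ {n} {G : Graph n} {k} → γtR≤ G k → (∀ f → IsTRDF G f → k ≤ weight f) → IsγtR G k
IsγtR-intro (h , h-trdf , h≤k) k-min = (h , h-trdf , ≤-antisym h≤k (k-min h h-trdf)) , k-min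

-- {z, t} and {a, b} are different unordered pairs.
OtherPair : ∀ {n} → Fin n → Fin n → Fin n → Fin n → Set
OtherPair a b z t = (z ≡ a → t ≢ b) × (z ≡ b → t ≢ a)

OtherPair-missingˡ : ∀ {n} {a b z t : Fin n} → z ≢ a → t ≢ a → OtherPair a b z t
OtherPair-missingˡ z≢a t≢a = (λ z≡a → ⊥-elim (z≢a z≡a)) , (λ _ → t≢a)

OtherPair-missingʳ : ∀ {n} {a b z t : Fin n} → z ≢ b → t ≢ b → OtherPair a b z t
OtherPair-missingʳ z≢b t≢b = (λ _ → t≢b) , (λ z≡b → ⊥-elim (z≢b z≡b))

OtherPair-outside : ∀ {n} {a b z t : Fin n} → z ≢ a → z ≢ b → OtherPair a b z t
OtherPair-outside z≢a z≢b = (λ z≡a → ⊥-elim (z≢a z≡a)) , (λ z≡b → ⊥-elim (z≢b z≡b))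

samePair-false : ∀ {n} {a b z t : Fin n} → OtherPair a b z t → samePair a b z t ≡ false
samePair-false (not-ab , not-ba) = cong₂ _∨_ (∧-false not-ab) (∧-false not-ba)
  where
  ∧-false : ∀ {n} {x y c d : Fin n} → (x ≡ c → y ≢ d) → ⌊ x ≟ c ⌋ ∧ ⌊ y ≟ d ⌋ ≡ false
  ∧-false {x = x} {y} {c} {d} not-cd with x ≟ c
  ... | no _ = refl
  ... | yes x≡c with y ≟ d
  ...   | yes y≡d = ⊥-elim (not-cd x≡c y≡d)
  ...   | no _    = refl

addEdge-⊇ : ∀ {n} (G : Graph n) {a b} z t → Adjacent G z t → Adjacent (addEdge G a b) z t
addEdge-⊇ G z t zt rewrite zt = refl

addEdge-only : ∀ {n} (G : Graph n) {a b z t} → Adjacent (addEdge G a b) z t → OtherPair a b z t → Adjacent G z t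
addEdge-only G {z = z} {t} zt other =
  trans (sym (∨-identityʳ (G z t))) (subst (λ s → G z t ∨ s ≡ true) (samePair-false other) zt)

removeEdge-⊆ : ∀ {n} (G : Graph n) {u v} z t → Adjacent (removeEdge G u v) z t → Adjacent G z t
removeEdge-⊆ G z t zt with G z t
... | true  = refl
... | false = zt

removeEdge-keeps : ∀ {n} (G : Graph n) {u v z t} → Adjacent G z t → OtherPair u v z t →
                   Adjacent (removeEdge G u v) z t
removeEdge-keeps G zt other rewrite zt | samePair-false other = refl

removeEdge-comm : ∀ {n} (G : Graph n) u v z t → removeEdge G v u z t ≡ removeEdge G u v z t
removeEdge-comm G u v z t =
  cong (λ b → G z t ∧ not b) (∨-comm (⌊ z ≟ v ⌋ ∧ ⌊ t ≟ u ⌋) (⌊ z ≟ u ⌋ ∧ ⌊ t ≟ v ⌋))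

γtR≤-removeEdge-comm : ∀ {n} {G : Graph n} {u v k} → γtR≤ (removeEdge G v u) k → γtR≤ (removeEdge G u v) k
γtR≤-removeEdge-comm {G = G} {u} {v} (h , h-trdf , h≤k) =
  h , IsTRDF-mono (λ z t zt → trans (sym (removeEdge-comm G u v z t)) zt) ≤ᶠ-refl h-trdf , h≤k

neighbour≢non-neighbour : ∀ {n} {G : Graph n} {a b c} → Adjacent G a b → G a c ≡ false → b ≢ c
neighbour≢non-neighbour ab ac-absent refl with trans (sym ac-absent) ab
... | ()

length-unique-singleton : ∀ {A : Set} {v : A} {xs : List A} → Unique xs → All (_≡ v) xs → v ∈ xs → length xs ≡ 1
length-unique-singleton {xs = _ ∷ []}    _               _               _ = refl
length-unique-singleton {xs = _ ∷ _ ∷ _} ((x≢y ∷ _) ∷ _) (x≡v ∷ y≡v ∷ _) _ = ⊥-elim (x≢y (trans x≡v (sym y≡v)))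

second-neighbour : ∀ {n} (G : Graph n) {u v} → Adjacent G u v → degree G u ≢ 1 → ∃[ w ] (Adjacent G u w × w ≢ v)
second-neighbour {n} G {u} {v} uv deg≢1 with any? (λ w → (G u w Bool.≟ true) ×-dec ¬? (w ≟ v))
... | yes found = found
... | no ¬found = ⊥-elim (deg≢1 (length-unique-singleton
        (Unique.filter⁺ (T? ∘ G u) (Unique.allFin⁺ n))
        (All.map only-v (All.all-filter (T? ∘ G u) (allFin n)))
        (∈-filter⁺ (T? ∘ G u) (∈-allFin v) (Equivalence.from T-≡ uv))))
  where
  only-v : ∀ {w} → T (G u w) → w ≡ v
  only-v {w} uw with w ≟ v
  ... | yes w≡v = w≡v
  ... | no w≢v  = ⊥-elim (¬found (w , Equivalence.to T-≡ uw , w≢v))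

-- Automorphisms and twins

IsAutomorphism : ∀ {n} → Graph n → Permutation n n → Set
IsAutomorphism G π = ∀ x y → G (π ⟨$⟩ʳ x) (π ⟨$⟩ʳ y) ≡ G x y

IsTRDF-∘-automorphism : ∀ {n} {G : Graph n} {π f} → IsAutomorphism G π → IsTRDF G f → IsTRDF G (f ∘ (π ⟨$⟩ʳ_))
IsTRDF-∘-automorphism {G = G} {π} {f} aut f-trdf = IsTRDF⁺ λ z →
  let (when-zero , when-pos) = IsTRDF⁻ f-trdf (π ⟨$⟩ʳ z) in
  (λ fπz≡0 → pull-back {_≡ 2} z (when-zero fπz≡0)) , (λ fπz≢0 → pull-back {_≢ 0} z (when-pos fπz≢0))
  where
  pull-back : ∀ {P : ℕ → Set} z → ∃[ t ] (Adjacent G (π ⟨$⟩ʳ z) t × P (toℕ (f t))) →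
              ∃[ t ] (Adjacent G z t × P (toℕ (f (π ⟨$⟩ʳ t))))
  pull-back {P} z (t , πz-t , Pt) =
    π ⟨$⟩ˡ t ,
    trans (sym (aut z (π ⟨$⟩ˡ t))) (subst (λ s → G (π ⟨$⟩ʳ z) s ≡ true) (sym (inverseʳ π)) πz-t) ,
    subst (P ∘ toℕ ∘ f) (sym (inverseʳ π)) Pt

data TransposeView {n} (a b z : Fin n) : Fin n → Set where
  at-a      : z ≡ a → TransposeView a b z b
  at-b      : z ≡ b → TransposeView a b z a
  elsewhere : z ≢ a → z ≢ b → TransposeView a b z z

transposeView : ∀ {n} (a b z : Fin n) → TransposeView a b z (transpose a b ⟨$⟩ʳ z)
transposeView a b z with z ≟ a
... | yes z≡a = at-a z≡a
... | no z≢a with z ≟ b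
...   | yes z≡b = at-b z≡b
...   | no z≢b  = elsewhere z≢a z≢b

transpose-first : ∀ {n} (a b : Fin n) → transpose a b ⟨$⟩ʳ a ≡ b
transpose-first a b with transpose a b ⟨$⟩ʳ a | transposeView a b a
... | _ | at-a _          = refl
... | _ | at-b refl       = refl
... | _ | elsewhere a≢a _ = ⊥-elim (a≢a refl)

transpose-second : ∀ {n} (a b : Fin n) → transpose a b ⟨$⟩ʳ b ≡ a
transpose-second a b with transpose a b ⟨$⟩ʳ b | transposeView a b b
... | _ | at-a refl       = refl
... | _ | at-b _          = refl
... | _ | elsewhere _ b≢b = ⊥-elim (b≢b refl)

transpose-other : ∀ {n} {a b z : Fin n} → z ≢ a → z ≢ b → transpose a b ⟨$⟩ʳ z ≡ z
transpose-other {a = a} {b} {z} z≢a z≢b with transpose a b ⟨$⟩ʳ z | transposeView a b z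
... | _ | at-a z≡a      = ⊥-elim (z≢a z≡a)
... | _ | at-b z≡b      = ⊥-elim (z≢b z≡b)
... | _ | elsewhere _ _ = refl

PrivateNeighbour : ∀ {n} → Graph n → Fin n → Fin n → Fin n → Set
PrivateNeighbour G a b y = Adjacent G a y × y ≢ b × G b y ≡ false

private-neighbour? : ∀ {n} (G : Graph n) a b → Dec (∃ (PrivateNeighbour G a b))
private-neighbour? G a b = any? λ y → (G a y Bool.≟ true) ×-dec (¬? (y ≟ b) ×-dec (G b y Bool.≟ false))

no-private-neighbour : ∀ {n} {G : Graph n} {a b} → ¬ ∃ (PrivateNeighbour G a b) →
                       ∀ {y} → Adjacent G a y → y ≢ b → Adjacent G b y
no-private-neighbour none ay y≢b = ¬-not λ by-absent → none (_ , ay , y≢b , by-absent)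

Twins : ∀ {n} → Graph n → Fin n → Fin n → Set
Twins {n} G a b = Adjacent G a b × (∀ z → z ≢ a → z ≢ b → G a z ≡ G b z)

Twins-intro : ∀ {n} {G : Graph n} {a b} → Adjacent G a b →
              ¬ ∃ (PrivateNeighbour G a b) → ¬ ∃ (PrivateNeighbour G b a) → Twins G a b
Twins-intro {G = G} ab none-ab none-ba = ab , λ z z≢a z≢b →
  ⇔→≡ {z = true} (mk⇔ (λ az → no-private-neighbour {G = G} none-ab az z≢b)
                      (λ bz → no-private-neighbour {G = G} none-ba bz z≢a))

module SimpleGraph {n} {G : Graph n} (simple : IsSimple G) where

  private
    symm = proj₁ simple
    irr = proj₂ simple

  adjacent-sym : ∀ {x y} → Adjacent G x y → Adjacent G y x
  adjacent-sym {x} {y} xy = trans (symm y x) xy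

  adjacent⇒≢ : ∀ {x y} → Adjacent G x y → x ≢ y
  adjacent⇒≢ {x} xy refl with trans (sym (irr x)) xy
  ... | ()

  transpose-twins : ∀ {a b} → Twins G a b → IsAutomorphism G (transpose a b)
  transpose-twins {a} {b} (ab , twin) x y
    with transpose a b ⟨$⟩ʳ x | transposeView a b x | transpose a b ⟨$⟩ʳ y | transposeView a b y
  ... | _ | at-a refl       | _ | at-a refl       = trans (irr b) (sym (irr a))
  ... | _ | at-a refl       | _ | at-b refl       = symm b a
  ... | _ | at-a refl       | _ | elsewhere ya yb = sym (twin y ya yb)
  ... | _ | at-b refl       | _ | at-a refl       = symm a b
  ... | _ | at-b refl       | _ | at-b refl       = trans (irr a) (sym (irr b))
  ... | _ | at-b refl       | _ | elsewhere ya yb = twin y ya yb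
  ... | _ | elsewhere xa xb | _ | at-a refl       = trans (symm x b) (trans (sym (twin x xa xb)) (symm a x))
  ... | _ | elsewhere xa xb | _ | at-b refl       = trans (symm x a) (trans (twin x xa xb) (symm b x))
  ... | _ | elsewhere _ _   | _ | elsewhere _ _   = refl

  Twins-trans : ∀ {u v w} → Twins G u v → Twins G u w → v ≢ w → Twins G v w
  Twins-trans {u} {v} {w} (uv , twin-uv) (uw , twin-uw) v≢w = vw , twin-vw
    where
    w≢u = adjacent⇒≢ uw ∘ sym
    vw : Adjacent G v w
    vw = trans (sym (twin-uv w w≢u (v≢w ∘ sym))) uw
    twin-vw : ∀ z → z ≢ v → z ≢ w → G v z ≡ G w z
    twin-vw z z≢v z≢w with z ≟ u
    ... | yes refl = trans (adjacent-sym uv) (sym (adjacent-sym uw))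
    ... | no z≢u   = trans (sym (twin-uv z z≢u z≢v)) (twin-uw z z≢u z≢w)

-- Removing an edge from a supercritical graph

module Removal {n} (G : Graph n) (simple : IsSimple G) {k} (γ : IsγtR G k)
               (supercritical : ∀ x y → x ≢ y → G x y ≡ false →
                                ∀ k k′ → IsγtR G k → IsγtR (addEdge G x y) k′ → k′ + 2 ≤ k) where

  open SimpleGraph simple

  private
    symm = proj₁ simple
    k-min = proj₂ γ

  adding-lightens : ∀ x y → x ≢ y → G x y ≡ false → ∃[ g ] (IsTRDF (addEdge G x y) g × weight g + 2 ≤ k)
  adding-lightens x y x≢y xy-absent
    with γtR-exists (addEdge G x y) (IsTRDF-mono (addEdge-⊇ G) ≤ᶠ-refl (proj₁ (proj₂ (proj₁ γ))))
  ... | k′ , γ′@((g , g-trdf , refl) , _) = g , g-trdf , supercritical x y x≢y xy-absent k k′ γ γ′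

  module _ {u v} (uv : Adjacent G u v) where

    private
      G-uv = removeEdge G u v
      u≢v = adjacent⇒≢ uv
      v≢u = u≢v ∘ sym

    G-uv-from-u : ∀ {t} → Adjacent G u t → t ≢ v → Adjacent G-uv u t
    G-uv-from-u ut t≢v = removeEdge-keeps G ut (OtherPair-missingʳ u≢v t≢v)

    G-uv-to-u : ∀ {t} → Adjacent G u t → t ≢ v → Adjacent G-uv t u
    G-uv-to-u ut t≢v = removeEdge-keeps G (adjacent-sym ut) (OtherPair-missingʳ t≢v u≢v)

    G-uv-from-v : ∀ {t} → Adjacent G v t → t ≢ u → Adjacent G-uv v t
    G-uv-from-v vt t≢u = removeEdge-keeps G vt (OtherPair-missingˡ v≢u t≢u)

    G-uv-to-v : ∀ {t} → Adjacent G v t → t ≢ u → Adjacent G-uv t v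
    G-uv-to-v vt t≢u = removeEdge-keeps G (adjacent-sym vt) (OtherPair-missingˡ t≢u v≢u)

    G-uv-outside : ∀ {z t} → z ≢ u → z ≢ v → Adjacent G z t → Adjacent G-uv z t
    G-uv-outside z≢u z≢v zt = removeEdge-keeps G zt (OtherPair-outside z≢u z≢v)

    module Lighter {x y g} (g-trdf : IsTRDF (addEdge G x y) g) (g-light : weight g + 2 ≤ k) where

      within-budget : ∀ {h : Labelling n} → weight h ≤ weight g + 2 → weight h ≤ k
      within-budget {h} h≤g+2 = ≤-trans {weight h} h≤g+2 g-light

      not-lighter : ∀ {h} → IsTRDF G h → weight h ≤ weight g + 1 → ⊥
      not-lighter {h} h-trdf h≤g+1 = <-irrefl refl (begin-strict
        weight g + 1 <⟨ +-monoʳ-< (weight g) ≤-refl ⟩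
        weight g + 2 ≤⟨ g-light ⟩
        k            ≤⟨ k-min h h-trdf ⟩
        weight h     ≤⟨ h≤g+1 ⟩
        weight g + 1 ∎)
        where open ≤-Reasoning

      untouched-in-G : ∀ {h z} → g ≤ᶠ h → z ≢ x → z ≢ y → IsTRDFAt G h z
      untouched-in-G g≤h z≢x z≢y =
        IsTRDFAt-mono (λ _ zt _ → addEdge-only G zt (OtherPair-outside z≢x z≢y)) g≤h (IsTRDF⁻ g-trdf _)

      untouched : ∀ {h z} → g ≤ᶠ h → z ≢ x → z ≢ y → z ≢ u → z ≢ v → IsTRDFAt G-uv h z
      untouched g≤h z≢x z≢y z≢u z≢v =
        IsTRDFAt-mono (λ _ zt _ → G-uv-outside z≢u z≢v (addEdge-only G zt (OtherPair-outside z≢x z≢y)))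
                      g≤h (IsTRDF⁻ g-trdf _)

    unlabelled-u : ∀ {y w g} → Adjacent G u w → w ≢ v → IsTRDF (addEdge G u y) g → weight g + 2 ≤ k →
                   toℕ (g u) ≡ 0 → γtR≤ G-uv k
    unlabelled-u {y} {w} {g} uw w≢v g-trdf g-light gu≡0 = h , IsTRDF⁺ at , within-budget (weight-raise₂ g u w)
      where
      open Lighter g-trdf g-light
      h = raise (raise g u) w
      at : ∀ z → IsTRDFAt G-uv h z
      at z with z ≟ u | z ≟ w
      ... | yes refl | _        = IsTRDFAt-pos w (raise₂-pos₁ g u w) (G-uv-from-u uw w≢v) (raise-pos _ w)
      ... | no _     | yes refl = IsTRDFAt-pos u (raise-pos _ w) (G-uv-to-u uw w≢v) (raise₂-pos₁ g u w)
      ... | no z≢u   | no _     = IsTRDFAt-mono edges (raise₂-≥ g u w) (IsTRDF⁻ g-trdf z)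
        where
        edges : ∀ t → Adjacent (addEdge G u y) z t → toℕ (g t) ≢ 0 → Adjacent G-uv z t
        edges t zt gt≢0 = removeEdge-keeps G (addEdge-only G zt avoids-u) avoids-u
          where
          avoids-u : ∀ {b} → OtherPair u b z t
          avoids-u = OtherPair-missingˡ z≢u λ { refl → gt≢0 gu≡0 }

    v-private-neighbour : ∀ {y w} → PrivateNeighbour G v u y → Adjacent G u w → w ≢ v → γtR≤ G-uv k
    v-private-neighbour {y} {w} (vy , y≢u , uy-absent) uw w≢v with adding-lightens u y (y≢u ∘ sym) uy-absent
    ... | g , g-trdf , g-light = by-labels
      where
      open Lighter g-trdf g-light
      y≢v = neighbour≢non-neighbour {G = G} uv uy-absent ∘ sym

      u-and-y-labelled : toℕ (g u) ≢ 0 → toℕ (g y) ≢ 0 → γtR≤ G-uv k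
      u-and-y-labelled gu≢0 gy≢0 = h , IsTRDF⁺ at , within-budget (weight-raise₂ g v w)
        where
        h = raise (raise g v) w
        g≤h = raise₂-≥ g v w
        at : ∀ z → IsTRDFAt G-uv h z
        at z with z ≟ u | z ≟ v | z ≟ w | z ≟ y
        ... | yes refl | _        | _        | _        =
          IsTRDFAt-pos w (pos-mono (g≤h u) gu≢0) (G-uv-from-u uw w≢v) (raise-pos _ w)
        ... | no _     | yes refl | _        | _        =
          IsTRDFAt-pos y (raise₂-pos₁ g v w) (G-uv-from-v vy y≢u) (pos-mono (g≤h y) gy≢0)
        ... | no _     | no _     | yes refl | _        =
          IsTRDFAt-pos u (raise-pos _ w) (G-uv-to-u uw w≢v) (pos-mono (g≤h u) gu≢0)
        ... | no _     | no _     | no _     | yes refl =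
          IsTRDFAt-pos v (pos-mono (g≤h y) gy≢0) (G-uv-to-v vy y≢u) (raise₂-pos₁ g v w)
        ... | no z≢u   | no z≢v   | no _     | no z≢y   = untouched g≤h z≢u z≢y z≢u z≢v

      positive-neighbour-of-u : toℕ (g u) ≢ 0 → toℕ (g y) ≡ 0 → ∀ {p} → Adjacent (addEdge G u y) u p →
                                toℕ (g p) ≢ 0 → p ≢ v → γtR≤ G-uv k
      positive-neighbour-of-u gu≢0 gy≡0 {p} up gp≢0 p≢v = h , IsTRDF⁺ at , within-budget (weight-raise₂ g y v)
        where
        h = raise (raise g y) v
        g≤h = raise₂-≥ g y v
        up-in-G : Adjacent G u p
        up-in-G = addEdge-only G up (OtherPair-missingʳ (y≢u ∘ sym) λ { refl → gp≢0 gy≡0 })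
        at : ∀ z → IsTRDFAt G-uv h z
        at z with z ≟ u | z ≟ v | z ≟ y
        ... | yes refl | _        | _        =
          IsTRDFAt-pos p (pos-mono (g≤h u) gu≢0) (G-uv-from-u up-in-G p≢v) (pos-mono (g≤h p) gp≢0)
        ... | no _     | yes refl | _        = IsTRDFAt-pos y (raise-pos _ v) (G-uv-from-v vy y≢u) (raise₂-pos₁ g y v)
        ... | no _     | no _     | yes refl = IsTRDFAt-pos v (raise₂-pos₁ g y v) (G-uv-to-v vy y≢u) (raise-pos _ v)
        ... | no z≢u   | no z≢v   | no z≢y   = untouched g≤h z≢u z≢y z≢u z≢v

      v-unlabelled : toℕ (g v) ≢ 0 → ⊥
      v-unlabelled gv≢0 = not-lighter (IsTRDF⁺ at) (weight-set2-pos g v gv≢0)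
        where
        at : ∀ z → IsTRDFAt G (set2 g v) z
        at z with z ≟ u | z ≟ y
        ... | yes refl | _        = IsTRDFAt-two v uv (set2-two g v)
        ... | no _     | yes refl = IsTRDFAt-two v (adjacent-sym vy) (set2-two g v)
        ... | no z≢u   | no z≢y   = untouched-in-G (set2-≥ g v) z≢u z≢y

      by-labels : γtR≤ G-uv k
      by-labels with toℕ (g u) ≟ℕ 0 | toℕ (g y) ≟ℕ 0
      ... | yes gu≡0 | _        = unlabelled-u uw w≢v g-trdf g-light gu≡0
      ... | no gu≢0  | no gy≢0  = u-and-y-labelled gu≢0 gy≢0
      ... | no gu≢0  | yes gy≡0 with IsTRDFAt.when-pos (IsTRDF⁻ g-trdf u) gu≢0
      ...   | p , up , gp≢0 with p ≟ v
      ...     | no p≢v   = positive-neighbour-of-u gu≢0 gy≡0 up gp≢0 p≢v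
      ...     | yes refl = ⊥-elim (v-unlabelled gp≢0)

    non-adjacent-common-neighbours : ∀ {s t} → Adjacent G u s → Adjacent G v s → Adjacent G u t → Adjacent G v t →
                                     s ≢ t → G s t ≡ false → γtR≤ G-uv k
    non-adjacent-common-neighbours {s} {t} us vs ut vt s≢t st-absent with adding-lightens s t s≢t st-absent
    ... | g , g-trdf , g-light = by-labels
      where
      open Lighter g-trdf g-light
      s≢v = adjacent⇒≢ vs ∘ sym
      t≢v = adjacent⇒≢ vt ∘ sym

      labelled-two : ∀ {m} → Adjacent G u m → Adjacent G v m → toℕ (g m) ≡ 2 → γtR≤ G-uv k
      labelled-two {m} um vm gm≡2 = h , IsTRDF⁺ at , within-budget (weight-set2 g u)
        where
        h = set2 g u
        hm≡2 = two-mono (set2-≥ g u m) gm≡2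
        at : ∀ z → IsTRDFAt G-uv h z
        at z with z ≟ u | z ≟ v | z ≟ s | z ≟ t
        ... | yes refl | _        | _        | _        = IsTRDFAt-two m (G-uv-from-u um (adjacent⇒≢ vm ∘ sym)) hm≡2
        ... | no _     | yes refl | _        | _        = IsTRDFAt-two m (G-uv-from-v vm (adjacent⇒≢ um ∘ sym)) hm≡2
        ... | no _     | no _     | yes refl | _        = IsTRDFAt-two u (G-uv-to-u us s≢v) (set2-two g u)
        ... | no _     | no _     | no _     | yes refl = IsTRDFAt-two u (G-uv-to-u ut t≢v) (set2-two g u)
        ... | no z≢u   | no z≢v   | no z≢s   | no z≢t   = untouched (set2-≥ g u) z≢s z≢t z≢u z≢v

      labelled : ∀ {m} → Adjacent G u m → Adjacent G v m → toℕ (g m) ≢ 0 → toℕ (g s) ≢ 2 → toℕ (g t) ≢ 2 →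
                 γtR≤ G-uv k
      labelled {m} um vm gm≢0 gs≢2 gt≢2 = h , IsTRDF⁺ at , within-budget (weight-raise₂ g u v)
        where
        h = raise (raise g u) v
        g≤h = raise₂-≥ g u v
        -- The 2-neighbour of an unlabelled end of st is not the other end, which is not labelled 2.
        endpoint : ∀ {a b} → Adjacent G u a → a ≢ v → toℕ (g b) ≢ 2 → (∀ {c} → c ≢ b → OtherPair s t a c) →
                   IsTRDFAt G-uv h a
        endpoint {a} ua a≢v gb≢2 other = when-zero , λ _ → u , G-uv-to-u ua a≢v , raise₂-pos₁ g u v
          where
          when-zero : toℕ (h a) ≡ 0 → ∃[ c ] (Adjacent G-uv a c × toℕ (h c) ≡ 2)
          when-zero ha≡0 with IsTRDFAt.when-zero (IsTRDF⁻ g-trdf a) (zero-antimono g≤h ha≡0)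
          ... | c , ac , gc≡2 =
            c , G-uv-outside (adjacent⇒≢ ua ∘ sym) a≢v (addEdge-only G ac (other λ { refl → gb≢2 gc≡2 })) ,
            two-mono (g≤h c) gc≡2
        at : ∀ z → IsTRDFAt G-uv h z
        at z with z ≟ u | z ≟ v | z ≟ s | z ≟ t
        ... | yes refl | _        | _        | _        =
          IsTRDFAt-pos m (raise₂-pos₁ g u v) (G-uv-from-u um (adjacent⇒≢ vm ∘ sym)) (pos-mono (g≤h m) gm≢0)
        ... | no _     | yes refl | _        | _        =
          IsTRDFAt-pos m (raise-pos _ v) (G-uv-from-v vm (adjacent⇒≢ um ∘ sym)) (pos-mono (g≤h m) gm≢0)
        ... | no _     | no _     | yes refl | _        = endpoint us s≢v gt≢2 (OtherPair-missingʳ s≢t)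
        ... | no _     | no _     | no _     | yes refl = endpoint ut t≢v gs≢2 (OtherPair-missingˡ (s≢t ∘ sym))
        ... | no z≢u   | no z≢v   | no z≢s   | no z≢t   = untouched g≤h z≢s z≢t z≢u z≢v

      unlabelled : toℕ (g s) ≡ 0 → toℕ (g t) ≡ 0 → ⊥
      unlabelled gs≡0 gt≡0 = not-lighter (IsTRDF⁺ at) (m≤m+n _ 1)
        where
        at : ∀ z → IsTRDFAt G g z
        at z with z ≟ s | z ≟ t
        ... | yes refl | _ = IsTRDFAt-mono
          (λ c sc gc≢0 → addEdge-only G sc (OtherPair-missingʳ s≢t λ { refl → gc≢0 gt≡0 }))
          ≤ᶠ-refl (IsTRDF⁻ g-trdf s)
        ... | no _ | yes refl = IsTRDFAt-mono
          (λ c tc gc≢0 → addEdge-only G tc (OtherPair-missingˡ (s≢t ∘ sym) λ { refl → gc≢0 gs≡0 }))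
          ≤ᶠ-refl (IsTRDF⁻ g-trdf t)
        ... | no z≢s | no z≢t = untouched-in-G ≤ᶠ-refl z≢s z≢t

      by-labels : γtR≤ G-uv k
      by-labels with toℕ (g s) ≟ℕ 2 | toℕ (g t) ≟ℕ 2
      ... | yes gs≡2 | _        = labelled-two us vs gs≡2
      ... | no _     | yes gt≡2 = labelled-two ut vt gt≡2
      ... | no gs≢2  | no gt≢2 with toℕ (g s) ≟ℕ 0 | toℕ (g t) ≟ℕ 0
      ...   | no gs≢0  | _        = labelled us vs gs≢0 gs≢2 gt≢2
      ...   | yes _    | no gt≢0  = labelled ut vt gt≢0 gs≢2 gt≢2
      ...   | yes gs≡0 | yes gt≡0 = ⊥-elim (unlabelled gs≡0 gt≡0)

    neighbour-of-common-neighbour : ∀ {w y} → Adjacent G u w → Adjacent G v w → PrivateNeighbour G w u y →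
                                    γtR≤ G-uv k
    neighbour-of-common-neighbour {w} {y} uw vw (wy , y≢u , uy-absent)
      with adding-lightens u y (y≢u ∘ sym) uy-absent
    ... | g , g-trdf , g-light with toℕ (g u) ≟ℕ 0
    ...   | yes gu≡0 = unlabelled-u uw (adjacent⇒≢ vw ∘ sym) g-trdf g-light gu≡0
    ...   | no gu≢0 = h , IsTRDF⁺ at , within-budget (weight-set2 g w)
      where
      open Lighter g-trdf g-light
      w≢u = adjacent⇒≢ uw ∘ sym
      w≢v = adjacent⇒≢ vw ∘ sym
      y≢v = neighbour≢non-neighbour {G = G} uv uy-absent ∘ sym
      h = set2 g w
      hw≡2 = set2-two g w
      at : ∀ z → IsTRDFAt G-uv h z
      at z with z ≟ u | z ≟ v | z ≟ w | z ≟ y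
      ... | yes refl | _        | _        | _        = IsTRDFAt-two w (G-uv-from-u uw w≢v) hw≡2
      ... | no _     | yes refl | _        | _        = IsTRDFAt-two w (G-uv-from-v vw w≢u) hw≡2
      ... | no _     | no _     | yes refl | _        =
        IsTRDFAt-pos u (two⇒pos hw≡2) (G-uv-to-u uw w≢v) (pos-mono (set2-≥ g w u) gu≢0)
      ... | no _     | no _     | no _     | yes refl = IsTRDFAt-two w (G-uv-outside y≢u y≢v (adjacent-sym wy)) hw≡2
      ... | no z≢u   | no z≢v   | no _     | no z≢y   = untouched (set2-≥ g w) z≢u z≢y z≢u z≢v

    dominated-by-common-neighbour : ∀ {w f} → Adjacent G u w → Adjacent G v w → IsTRDF G f →
                                    toℕ (f u) ≤ toℕ (f w) → toℕ (f v) ≤ toℕ (f w) → IsTRDF G-uv f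
    dominated-by-common-neighbour {w} {f} uw vw f-trdf fu≤fw fv≤fw = IsTRDF⁺ at
      where
      endpoint : ∀ {a b} → (∀ {c} → Adjacent G a c → c ≢ b → Adjacent G-uv a c) → Adjacent G a w → w ≢ b →
                 toℕ (f a) ≤ toℕ (f w) → toℕ (f b) ≤ toℕ (f w) → IsTRDFAt G-uv f a
      endpoint {a} {b} keep aw w≢b fa≤fw fb≤fw = when-zero , λ fa≢0 → w , keep aw w≢b , pos-mono fa≤fw fa≢0
        where
        when-zero : toℕ (f a) ≡ 0 → ∃[ c ] (Adjacent G-uv a c × toℕ (f c) ≡ 2)
        when-zero fa≡0 with IsTRDFAt.when-zero (IsTRDF⁻ f-trdf a) fa≡0
        ... | c , ac , fc≡2 with c ≟ b
        ...   | yes refl = w , keep aw w≢b , two-mono fb≤fw fc≡2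
        ...   | no c≢b   = c , keep ac c≢b , fc≡2
      at : ∀ z → IsTRDFAt G-uv f z
      at z with z ≟ u | z ≟ v
      ... | yes refl | _        = endpoint G-uv-from-u uw (adjacent⇒≢ vw ∘ sym) fu≤fw fv≤fw
      ... | no _     | yes refl = endpoint G-uv-from-v vw (adjacent⇒≢ uw ∘ sym) fv≤fw fu≤fw
      ... | no z≢u   | no z≢v   = IsTRDFAt-mono (λ _ zt _ → G-uv-outside z≢u z≢v zt) ≤ᶠ-refl (IsTRDF⁻ f-trdf z)

    twin-common-neighbour : ∀ {w} → Adjacent G u w → Adjacent G v w → Twins G u w → Twins G v w → γtR≤ G-uv k
    twin-common-neighbour {w} uw vw twin-uw twin-vw with proj₁ γ
    ... | f , f-trdf , f≡k = by-maximum
      where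
      w≢u = adjacent⇒≢ uw ∘ sym
      w≢v = adjacent⇒≢ vw ∘ sym
      ≤-along : ∀ {x y x′ y′} → x′ ≡ x → y′ ≡ y → toℕ (f x) ≤ toℕ (f y) → toℕ (f x′) ≤ toℕ (f y′)
      ≤-along refl refl fx≤fy = fx≤fy
      swap-maximum : ∀ {a b} → Twins G a w → b ≢ a → b ≢ w → toℕ (f w) ≤ toℕ (f a) → toℕ (f b) ≤ toℕ (f a) →
                     ∃[ f′ ] (IsTRDF G f′ × weight f′ ≡ k × toℕ (f′ a) ≤ toℕ (f′ w) × toℕ (f′ b) ≤ toℕ (f′ w))
      swap-maximum {a} {b} twin b≢a b≢w fw≤fa fb≤fa =
        f ∘ (σ ⟨$⟩ʳ_) ,
        IsTRDF-∘-automorphism {G = G} {σ} (transpose-twins twin) f-trdf ,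
        trans (weight-∘-permutation f σ) f≡k ,
        ≤-along (transpose-first a w) (transpose-second a w) fw≤fa ,
        ≤-along (transpose-other b≢a b≢w) (transpose-second a w) fb≤fa
        where σ = transpose a w
      max-at-w : toℕ (f u) ≤ toℕ (f w) → toℕ (f v) ≤ toℕ (f w) → γtR≤ G-uv k
      max-at-w fu≤fw fv≤fw = f , dominated-by-common-neighbour uw vw f-trdf fu≤fw fv≤fw , ≤-reflexive f≡k
      max-at-u : toℕ (f w) ≤ toℕ (f u) → toℕ (f v) ≤ toℕ (f u) → γtR≤ G-uv k
      max-at-u fw≤fu fv≤fu with swap-maximum twin-uw v≢u (w≢v ∘ sym) fw≤fu fv≤fu
      ... | f′ , f′-trdf , f′≡k , f′u≤f′w , f′v≤f′w =
        f′ , dominated-by-common-neighbour uw vw f′-trdf f′u≤f′w f′v≤f′w , ≤-reflexive f′≡k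
      max-at-v : toℕ (f w) ≤ toℕ (f v) → toℕ (f u) ≤ toℕ (f v) → γtR≤ G-uv k
      max-at-v fw≤fv fu≤fv with swap-maximum twin-vw u≢v (w≢u ∘ sym) fw≤fv fu≤fv
      ... | f′ , f′-trdf , f′≡k , f′v≤f′w , f′u≤f′w =
        f′ , dominated-by-common-neighbour uw vw f′-trdf f′u≤f′w f′v≤f′w , ≤-reflexive f′≡k
      by-maximum : γtR≤ G-uv k
      by-maximum with ≤-total (toℕ (f u)) (toℕ (f v))
      ... | inj₁ fu≤fv with ≤-total (toℕ (f v)) (toℕ (f w))
      ...   | inj₁ fv≤fw = max-at-w (≤-trans fu≤fv fv≤fw) fv≤fw
      ...   | inj₂ fw≤fv = max-at-v fw≤fv fu≤fv
      by-maximum | inj₂ fv≤fu with ≤-total (toℕ (f u)) (toℕ (f w))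
      ...   | inj₁ fu≤fw = max-at-w fu≤fw (≤-trans fv≤fu fu≤fw)
      ...   | inj₂ fw≤fu = max-at-u fw≤fu fv≤fu

    no-private-neighbours : ∀ {w} → Adjacent G u w → Adjacent G v w →
                            ¬ ∃ (PrivateNeighbour G u v) → ¬ ∃ (PrivateNeighbour G v u) → γtR≤ G-uv k
    no-private-neighbours {w} uw vw none-uv none-vu with private-neighbour? G u w | private-neighbour? G w u
    ... | yes (s , us , s≢w , ws-absent) | _ =
      non-adjacent-common-neighbours us (no-private-neighbour {G = G} none-uv us s≢v) uw vw s≢w
                                     (trans (symm s w) ws-absent)
      where
      s≢v = neighbour≢non-neighbour {G = G} (adjacent-sym vw) ws-absent ∘ sym
    ... | no _ | yes (_ , private-y) = neighbour-of-common-neighbour uw vw private-y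
    ... | no none-uw | no none-wu =
      twin-common-neighbour uw vw twin-uw (Twins-trans (Twins-intro uv none-uv none-vu) twin-uw (adjacent⇒≢ vw))
      where
      twin-uw = Twins-intro uw none-uw none-wu

  removeEdge-γtR≤ : ∀ {u v} → Adjacent G u v → degree G u ≢ 1 → degree G v ≢ 1 → γtR≤ (removeEdge G u v) k
  removeEdge-γtR≤ {u} {v} uv deg-u deg-v
    with second-neighbour G uv deg-u | second-neighbour G (adjacent-sym uv) deg-v
  ... | w , uw , w≢v | w′ , vw′ , w′≢u with private-neighbour? G v u | private-neighbour? G u v
  ...   | yes (_ , private-y) | _ = v-private-neighbour uv private-y uw w≢v
  ...   | no _ | yes (_ , private-y) =
    γtR≤-removeEdge-comm {G = G} (v-private-neighbour (adjacent-sym uv) private-y vw′ w′≢u)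
  ...   | no none-vu | no none-uv =
    no-private-neighbours uv uw (no-private-neighbour {G = G} none-uv uw w≢v) none-uv none-vu

theorem9p3 : ∀ {n : ℕ} (G : Graph n) → IsSimple G → IsSupercritical G →
    ∀ (u v : Fin n) → Adjacent G u v → degree G u ≢ 1 → degree G v ≢ 1 →
    ∀ (k : ℕ) → IsγtR G k → IsγtR (removeEdge G u v) k
theorem9p3 G simple (_ , _ , supercritical) u v uv deg-u deg-v k γ =
  IsγtR-intro (Removal.removeEdge-γtR≤ G simple γ supercritical uv deg-u deg-v)
              (λ h h-trdf → proj₂ γ h (IsTRDF-mono (removeEdge-⊆ G) ≤ᶠ-refl h-trdf))
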